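{- Let $I=(I_1,\ldots,I_k)$ be a set supercomposition, let $A\subset\mathbb{N}$ be finite with $|A|=k$, and let $\sigma\in\mathfrak{S}_\infty$. Then under the quasisymmetrizing action in noncommuting variables, $\sigma\cdot A^I=\sigma(A)^I$, where $\sigma(A)=\{\sigma(a):a\in A\}$.
   Context: $\mathbb{Q}^\theta\langle\langle x\rangle\rangle$: bounded-degree formal power series over $\mathbb{Q}$ in noncommuting $x_1,x_2,\ldots$ and $\theta_1,\theta_2,\ldots$ with $x_i\theta_j=\theta_jx_i$, $\theta_i\theta_j=-\theta_j\theta_i$; monomials in normal form $\theta_{i_1}\cdots\theta_{i_m}x_{j_1}\cdots x_{j_n}$, $i_1<\cdots<i_m$, with index set $\operatorname{ind}(u)=\{i_1,\ldots,i_m,j_1,\ldots,j_n\}$. A set supercomposition of bidegree $(n,m)$ is a sequence $(I_1,\ldots,I_k)$ of nonempty subsets of $\{0,\ldots,n\}$ with $I_i\cap I_j\subseteq\{0\}$ ($i\neq j$), $\bigcup(I_i\setminus\{0\})=[n]$, $m$ blocks containing $0$. To a monic monomial $u=\theta_{i_1}\cdots\theta_{i_m}x_{j_1}\cdots x_{j_n}$ associate the infinite sequence $\tilde I(u)=(I_1,I_2,\ldots)$ with $I_r=\{t\in[n]: j_t=r\}\cup(\{0\}$ if $r\in\{i_1,\ldots,i_m\})$; this is a bijection between monic monomials and sequences of subsets with finitely many nonempty terms whose nonempty terms form a set supercomposition, denoted $I(u)$. For a set supercomposition $I$ with $k$ blocks and $A$ with $|A|=k$, $A^I$ is the unique monic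 monomial with $\operatorname{ind}=A$ and $I(u)=I$. Action: the simple transposition $s_i$ exchanges $I_i$ and $I_{i+1}$ in $\tilde I(u)$ if at least one of them is empty, and acts trivially otherwise; this gives an action of $\mathfrak{S}_\infty$ on monic monomials, extended linearly. -}

module Defs where

open import Data.Nat using (ℕ; zero; suc; _⊔_; _≡ᵇ_; _<ᵇ_; _≤_)
open import Data.Bool using (Bool; true; false; _∧_; _∨_; not; if_then_else_)
open import Data.List using (List; []; _∷_; map; filter; foldr; length; upTo; _++_)
open import Data.Maybe using (Maybe; just; nothing)
open import Data.Vec using (Vec; []; _∷_)
open import Data.Fin using (Fin)
open import Data.Fin.Subset using (Subset; _∈_; Nonempty)
open import Data.Product using (∃; _×_)
open import Relation.Binary.PropositionalEquality using (_≡_; _≢_)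
open import Data.List.Relation.Unary.All using (All)
open import Relation.Nullary.Decidable using (⌊_⌋)
open import Data.Nat using (_≟_)

-- Monic monomials θ_{i₁}⋯θ_{i_m} x_{j₁}⋯x_{j_n}, stored as the list of
-- θ-indices (i₁,…,i_m) and the word of x-indices (j₁,…,j_n).
-- Variables are indexed by positive naturals 1,2,…

record Mon : Set where
  constructor mon
  field
    θs : List ℕ
    xs : List ℕ
open Mon public

anyB : (ℕ → Bool) → List ℕ → Bool
anyB p = foldr (λ a b → p a ∨ b) false

allB : (ℕ → Bool) → List ℕ → Bool
allB p = foldr (λ a b → p a ∧ b) true

elem : ℕ → List ℕ → Bool
elem r l = anyB (λ a → r ≡ᵇ a) l

nth : List ℕ → ℕ → Maybe ℕ
nth []       _       = nothing
nth (a ∷ l)  zero    = just a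
nth (a ∷ l)  (suc t) = nth l t

maxList : List ℕ → ℕ
maxList = foldr _⊔_ 0

range1 : ℕ → List ℕ
range1 B = map suc (upTo B)

-- Sequences of subsets: S r t = "t ∈ I_r" (r ≥ 1 the block index,
-- t ∈ {0,…,n} the element).
Seq : Set
Seq = ℕ → ℕ → Bool

-- Ĩ(u): I_r = {t ∈ [n] : j_t = r} ∪ ({0} if r ∈ {i₁,…,i_m})
Ĩ : Mon → Seq
Ĩ u r zero    = elem r (θs u)
Ĩ u r (suc t) with nth (xs u) t
... | just j  = r ≡ᵇ j
... | nothing = false

ind : Mon → List ℕ
ind u = θs u ++ xs u

findFirst : (ℕ → Bool) → List ℕ → Maybe ℕ
findFirst p []      = nothing
findFirst p (r ∷ l) = if p r then just r else findFirst p l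

fromMaybe0 : Maybe ℕ → ℕ
fromMaybe0 (just r) = r
fromMaybe0 nothing  = 0

-- Inverse of Ĩ: the monic monomial with n x-letters whose sequence is S,
-- given a bound B such that all nonempty blocks of S have index ≤ B.
decode : ℕ → ℕ → Seq → Mon
decode n B S =
  mon (filter (λ r → S r 0 Data.Bool.≟ true) (range1 B))
      (map (λ t → fromMaybe0 (findFirst (λ r → S r t) (range1 B))) (range1 n))

τ : ℕ → ℕ → ℕ
τ i r = if r ≡ᵇ i then suc i else (if r ≡ᵇ suc i then i else r)

blockEmpty : Mon → ℕ → Bool
blockEmpty u r = allB (λ t → not (Ĩ u r t)) (upTo (suc (length (xs u))))

sAct : ℕ → Mon → Mon
sAct i u =
  if blockEmpty u i ∨ blockEmpty u (suc i)
  then decode (length (xs u)) (suc i ⊔ maxList (ind u)) (λ r → Ĩ u (τ i r))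
  else u

-- A permutation σ ∈ 𝔖_∞ given as a word w = (w₁,…,w_l) in simple
-- transpositions: σ = s_{w₁} s_{w₂} ⋯ s_{w_l}.
act : List ℕ → Mon → Mon
act []      u = u
act (i ∷ w) u = sAct i (act w u)

perm : List ℕ → ℕ → ℕ
perm []      a = a
perm (i ∷ w) a = τ i (perm w a)

-- Set supercompositions: blocks are subsets of {0,…,n} = Fin (suc n)
-- (Fin.zero is the element 0, Fin.suc t is the element t+1).

nthBlock : ∀ {n} → List (Subset (suc n)) → ℕ → Maybe (Subset (suc n))
nthBlock []      _       = nothing
nthBlock (b ∷ l) zero    = just b
nthBlock (b ∷ l) (suc p) = nthBlock l p

record IsSetSupercomp (n : ℕ) (I : List (Subset (suc n))) : Set where
  field
    nonempty : All Nonempty I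
    disjoint : ∀ p q (Ip Iq : Subset (suc n)) → p ≢ q →
               nthBlock I p ≡ just Ip → nthBlock I q ≡ just Iq →
               ∀ (t : Fin (suc n)) → t ∈ Ip → t ∈ Iq → t ≡ Fin.zero
    covers   : ∀ (t : Fin n) → ∃ λ p → ∃ λ (Ip : Subset (suc n)) →
               nthBlock I p ≡ just Ip × Fin.suc t ∈ Ip

inSub : ∀ {m} → Vec Bool m → ℕ → Bool
inSub []      _       = false
inSub (b ∷ v) zero    = b
inSub (b ∷ v) (suc t) = inSub v t

rank : List ℕ → ℕ → ℕ
rank A r = length (filter (λ a → a Data.Nat.<? r) A)

-- A^I: the monic monomial u with ind(u) = A and I(u) = I, i.e.
-- Ĩ(u)_{a_j} = I_j for a₁ < ⋯ < a_k the elements of A, other blocks empty.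
powSeq : ∀ {n} → List ℕ → List (Subset (suc n)) → Seq
powSeq A I r t with elem r A
... | false = false
... | true with nthBlock I (rank A r)
...   | just b  = inSub b t
...   | nothing = false

pow : ∀ {n} → List ℕ → List (Subset (suc n)) → Mon
pow {n} A I = decode n (maxList A) (powSeq A I)

-- By induction on the word it
-- suffices to treat one simple transposition s_i, i ≥ 1.  If i and i+1 both lie
-- in A, both blocks of A^I are nonempty, so s_i acts trivially; and τ_i maps A
-- onto itself, so s_i(A)^I = A^I as well.  Otherwise s_i swaps an empty block
-- with its neighbour, and the swapped sequence is the one of τ_i(A): τ_i(a) has
-- the same rank in τ_i(A) as a has in A, because τ_i preserves the order of any
-- two elements of A (it reverses only the pair {i, i+1}, which is not inside A).

module Submission where

open import Defs
open import Data.Nat using (ℕ; zero; suc; _≤_; _<_; _≮_; _≤′_; ≤′-reflexive; ≤′-step; z≤n; s≤s; s≤s⁻¹; s<s; s<s⁻¹; _⊔_; _≡ᵇ_; _≟_; _≤?_; _<?_)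
open import Data.Nat.Properties
open import Data.Bool using (Bool; true; false; _∧_; _∨_; not; T)
import Data.Bool as Bool
open import Data.Bool.Properties using (¬-not)
open import Data.Maybe using (just; nothing)
open import Data.List using (List; []; _∷_; [_]; map; filter; length; upTo; applyUpTo; _++_)
open import Data.List.Properties using (length-map; length-applyUpTo; map-id; map-∘; map-applyUpTo; map-cong-local; applyUpTo-∷ʳ; ++-identityʳ; filter-++; filter-none; filter-accept; filter-reject; filter-notAll)
open import Data.List.Membership.Propositional using (_∈_; _∉_)
open import Data.List.Membership.DecPropositional _≟_ using (_∈?_)
open import Data.List.Membership.Propositional.Properties using (∈-map⁺; ∈-map⁻; ∈-++⁺ˡ; ∈-++⁺ʳ; ∈-filter⁺; ∈-filter⁻; ∈-applyUpTo⁺; ∈-applyUpTo⁻; ∈-upTo⁺; ∈-upTo⁻)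
open import Data.List.Membership.Propositional.Properties.WithK using (unique∧set⇒bag)
open import Data.List.Relation.Unary.Any as Any using (here; there)
open import Data.List.Relation.Unary.All as All using (All; []; _∷_)
open import Data.List.Relation.Unary.Unique.Propositional using (Unique)
import Data.List.Relation.Unary.Unique.Propositional.Properties as Unique
open import Data.List.Relation.Binary.Permutation.Propositional using (_↭_; ↭-sym; ↭⇒↭ₛ; ↭ₛ⇒↭)
open import Data.List.Relation.Binary.Permutation.Propositional.Properties using (↭-length; ∈-resp-↭)
import Data.List.Relation.Binary.Permutation.Setoid.Properties as Permutationₛ
open import Data.List.Relation.Binary.BagAndSetEquality using (∼bag⇒↭)
open import Data.Fin using (Fin; toℕ)
import Data.Fin as Fin
open import Data.Fin.Properties using (toℕ-injective; toℕ<n)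
open import Data.Fin.Subset using (Subset) renaming (_∈_ to _∈ₛ_)
open import Data.Vec using (Vec; _∷_; here; there)
open import Data.Product using (∃; _×_; _,_; proj₂)
open import Function using (id; _∘_; _⇔_; mk⇔; Equivalence)
import Function.Properties.Equivalence as ⇔
open import Relation.Nullary using (¬_; yes; no; does; ¬?; T?; contradiction)
import Relation.Nullary.Decidable as Dec
open import Relation.Nullary.Decidable using (does-≡; dec-true; dec-false)
open import Relation.Unary using (Decidable)
open import Relation.Binary.Definitions using (tri<; tri≈; tri>)
open import Relation.Binary.PropositionalEquality hiding ([_])

-- Lists

elem≡does : ∀ r l → elem r l ≡ does (r ∈? l)
elem≡does r []      = refl
elem≡does r (a ∷ l) = cong ((r ≡ᵇ a) ∨_) (elem≡does r l)

elem-true : ∀ {r l} → r ∈ l → elem r l ≡ true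
elem-true {r} {l} r∈l = trans (elem≡does r l) (dec-true (r ∈? l) r∈l)

elem-false : ∀ {r l} → r ∉ l → elem r l ≡ false
elem-false {r} {l} r∉l = trans (elem≡does r l) (dec-false (r ∈? l) r∉l)

elem⇒∈ : ∀ {r l} → elem r l ≡ true → r ∈ l
elem⇒∈ {r} {l} eq with r ∈? l | elem≡does r l
... | yes r∈l | _          = r∈l
... | no _    | elem≡false = contradiction (trans (sym eq) elem≡false) λ ()

allB≡does : ∀ p l → allB p l ≡ does (All.all? (T? ∘ p) l)
allB≡does p []      = refl
allB≡does p (t ∷ l) = cong (p t ∧_) (allB≡does p l)

≡ᵇ-true : ∀ {a b} → a ≡ b → (a ≡ᵇ b) ≡ true
≡ᵇ-true {a} {b} = dec-true (a ≟ b)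

≡ᵇ-false : ∀ {a b} → a ≢ b → (a ≡ᵇ b) ≡ false
≡ᵇ-false {a} {b} = dec-false (a ≟ b)

∈⇒≤maxList : ∀ {r l} → r ∈ l → r ≤ maxList l
∈⇒≤maxList {l = a ∷ l} (here refl) = m≤m⊔n a (maxList l)
∈⇒≤maxList {l = a ∷ l} (there r∈l) = m≤n⇒m≤o⊔n a (∈⇒≤maxList r∈l)

range1≡applyUpTo : ∀ B → range1 B ≡ applyUpTo suc B
range1≡applyUpTo = map-applyUpTo id suc

∈-range1 : ∀ {r B} → r ∈ range1 B ⇔ (1 ≤ r × r ≤ B)
∈-range1 {r} {B} rewrite range1≡applyUpTo B = mk⇔ to from
  where
  to : r ∈ applyUpTo suc B → 1 ≤ r × r ≤ B
  to r∈ with t , t<B , refl ← ∈-applyUpTo⁻ suc r∈ = s≤s z≤n , t<B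
  from : 1 ≤ r × r ≤ B → r ∈ applyUpTo suc B
  from (s≤s _ , r≤B) = ∈-applyUpTo⁺ suc r≤B

range1-suc : ∀ B → range1 (suc B) ≡ range1 B ++ [ suc B ]
range1-suc B rewrite range1≡applyUpTo B | range1≡applyUpTo (suc B) = sym (applyUpTo-∷ʳ suc B)

nth-range1 : ∀ {n t} → t < n → nth (range1 n) t ≡ just (suc t)
nth-range1 {n} rewrite range1≡applyUpTo n = nth-applyUpTo suc
  where
  nth-applyUpTo : ∀ f {n t} → t < n → nth (applyUpTo f n) t ≡ just (f t)
  nth-applyUpTo f {suc n} {zero}  _         = refl
  nth-applyUpTo f {suc n} {suc t} (s≤s t<n) = nth-applyUpTo (f ∘ suc) t<n

nth-map : ∀ f {l t j} → nth l t ≡ just j → nth (map f l) t ≡ just (f j)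
nth-map f {a ∷ l} {zero}  refl = refl
nth-map f {a ∷ l} {suc t} eq   = nth-map f {l} eq

nth-∈ : ∀ {l t j} → nth l t ≡ just j → j ∈ l
nth-∈ {a ∷ l} {zero}  refl = here refl
nth-∈ {a ∷ l} {suc t} eq   = there (nth-∈ {l} eq)

findFirst-just : ∀ p {l x} → findFirst p l ≡ just x → p x ≡ true
findFirst-just p {r ∷ l} eq with p r in pr
... | true  with refl ← eq = pr
... | false = findFirst-just p {l} eq

findFirst-nothing : ∀ p {l x} → findFirst p l ≡ nothing → x ∈ l → p x ≡ false
findFirst-nothing p {r ∷ l} eq x∈ with p r in pr | x∈
... | true  | _         with () ← eq
... | false | here refl = pr
... | false | there x∈l = findFirst-nothing p eq x∈l

findFirst-++-none : ∀ p xs {ys} → All (λ y → p y ≡ false) ys → findFirst p (xs ++ ys) ≡ findFirst p xs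
findFirst-++-none p []       {[]}     []           = refl
findFirst-++-none p []       {y ∷ ys} (py ∷ rest) rewrite py = findFirst-++-none p [] rest
findFirst-++-none p (x ∷ xs) rest with p x
... | true  = refl
... | false = findFirst-++-none p xs rest

findFirst-cong-local : ∀ {p q l} → All (λ r → p r ≡ q r) l → findFirst p l ≡ findFirst q l
findFirst-cong-local []                                 = refl
findFirst-cong-local {q = q} {r ∷ _} (pr≡qr ∷ rest) rewrite pr≡qr with q r
... | true  = refl
... | false = findFirst-cong-local rest

filter-cong-local : ∀ {A : Set} {P Q : A → Set} (P? : Decidable P) (Q? : Decidable Q) {xs} →
                    All (λ x → P x ⇔ Q x) xs → filter P? xs ≡ filter Q? xs
filter-cong-local P? Q? []                      = refl
filter-cong-local P? Q? {x ∷ xs} (Px⇔Qx ∷ rest) with P? x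
... | yes Px = trans (cong (x ∷_) (filter-cong-local P? Q? rest)) (sym (filter-accept Q? (Equivalence.to Px⇔Qx Px)))
... | no ¬Px = trans (filter-cong-local P? Q? rest) (sym (filter-reject Q? (¬Px ∘ Equivalence.from Px⇔Qx)))

-- Transpositions

data TranspositionView (i a : ℕ) : Set where
  at-i    : a ≡ i → TranspositionView i a
  at-suc  : a ≡ suc i → TranspositionView i a
  outside : a ≢ i → a ≢ suc i → TranspositionView i a

transpositionView : ∀ i a → TranspositionView i a
transpositionView i a with a ≟ i | a ≟ suc i
... | yes a≡i | _         = at-i a≡i
... | no _    | yes a≡1+i = at-suc a≡1+i
... | no a≢i  | no a≢1+i  = outside a≢i a≢1+i

τ-left : ∀ i → τ i i ≡ suc i
τ-left i rewrite ≡ᵇ-true (refl {x = i}) = refl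

τ-right : ∀ i → τ i (suc i) ≡ i
τ-right i rewrite ≡ᵇ-false (1+n≢n {i}) | ≡ᵇ-true (refl {x = suc i}) = refl

τ-outside : ∀ {i a} → a ≢ i → a ≢ suc i → τ i a ≡ a
τ-outside a≢i a≢1+i rewrite ≡ᵇ-false a≢i | ≡ᵇ-false a≢1+i = refl

τ-involutive : ∀ i a → τ i (τ i a) ≡ a
τ-involutive i a with transpositionView i a
... | at-i refl   = trans (cong (τ i) (τ-left i)) (τ-right i)
... | at-suc refl = trans (cong (τ i) (τ-right i)) (τ-left i)
... | outside a≢i a≢1+i rewrite τ-outside a≢i a≢1+i = τ-outside a≢i a≢1+i

τ-injective : ∀ i {a b} → τ i a ≡ τ i b → a ≡ b
τ-injective i {a} {b} eq = begin
  a               ≡⟨ τ-involutive i a ⟨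
  τ i (τ i a)     ≡⟨ cong (τ i) eq ⟩
  τ i (τ i b)     ≡⟨ τ-involutive i b ⟩
  b               ∎
  where open ≡-Reasoning

τ-positive : ∀ {i a} → 1 ≤ i → 1 ≤ a → 1 ≤ τ i a
τ-positive {i} {a} 1≤i 1≤a with transpositionView i a
... | at-i refl         rewrite τ-left i              = s≤s z≤n
... | at-suc refl       rewrite τ-right i             = 1≤i
... | outside a≢i a≢1+i rewrite τ-outside a≢i a≢1+i = 1≤a

τ-fixes-large : ∀ {i a} → suc i < a → τ i a ≡ a
τ-fixes-large {i} 1+i<a =
  τ-outside (≢-sym (<⇒≢ (<-trans (n<1+n i) 1+i<a))) (≢-sym (<⇒≢ 1+i<a))

∈-map-τ : ∀ i {r A} → r ∈ map (τ i) A ⇔ τ i r ∈ A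
∈-map-τ i {r} = mk⇔ to from
  where
  to : ∀ {A} → r ∈ map (τ i) A → τ i r ∈ A
  to r∈ with a , a∈A , refl ← ∈-map⁻ (τ i) r∈ = subst (_∈ _) (sym (τ-involutive i a)) a∈A
  from : ∀ {A} → τ i r ∈ A → r ∈ map (τ i) A
  from τr∈A = subst (_∈ _) (τ-involutive i r) (∈-map⁺ (τ i) τr∈A)

perm-injective : ∀ w {a b} → perm w a ≡ perm w b → a ≡ b
perm-injective []      eq = eq
perm-injective (i ∷ w) eq = perm-injective w (τ-injective i eq)

<-⇔<-suc : ∀ {a i} → a ≢ i → a < i ⇔ a < suc i
<-⇔<-suc a≢i = mk⇔ m<n⇒m<1+n (λ a<1+i → ≤∧≢⇒< (s≤s⁻¹ a<1+i) a≢i)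

>-⇔>-suc : ∀ {a i} → a ≢ suc i → i < a ⇔ suc i < a
>-⇔>-suc {i = i} a≢1+i = mk⇔ (λ i<a → ≤∧≢⇒< i<a (≢-sym a≢1+i)) (<-trans (n<1+n i))

τ-preserves-< : ∀ i {a b} → ¬ (a ≡ i × b ≡ suc i) → ¬ (a ≡ suc i × b ≡ i) →
                τ i a < τ i b ⇔ a < b
τ-preserves-< i {a} {b} not-i,1+i not-1+i,i with transpositionView i a | transpositionView i b
... | at-i refl         | at-i refl         rewrite τ-left i  = mk⇔ s<s⁻¹ s<s
... | at-i refl         | at-suc refl       = contradiction (refl , refl) not-i,1+i
... | at-i refl         | outside b≢i b≢1+i rewrite τ-left i  | τ-outside b≢i b≢1+i = ⇔.sym (>-⇔>-suc b≢1+i)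
... | at-suc refl       | at-i refl         = contradiction (refl , refl) not-1+i,i
... | at-suc refl       | at-suc refl       rewrite τ-right i = mk⇔ s<s s<s⁻¹
... | at-suc refl       | outside b≢i b≢1+i rewrite τ-right i | τ-outside b≢i b≢1+i = >-⇔>-suc b≢1+i
... | outside a≢i a≢1+i | at-i refl         rewrite τ-outside a≢i a≢1+i | τ-left i  = ⇔.sym (<-⇔<-suc a≢i)
... | outside a≢i a≢1+i | at-suc refl       rewrite τ-outside a≢i a≢1+i | τ-right i = <-⇔<-suc a≢i
... | outside a≢i a≢1+i | outside b≢i b≢1+i rewrite τ-outside a≢i a≢1+i | τ-outside b≢i b≢1+i = ⇔.refl

τ-preserves-∈ : ∀ i {A x} → i ∈ A → suc i ∈ A → τ i x ∈ A ⇔ x ∈ A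
τ-preserves-∈ i {A} {x} i∈A 1+i∈A with transpositionView i x
... | at-i refl         rewrite τ-left i              = mk⇔ (λ _ → i∈A) (λ _ → 1+i∈A)
... | at-suc refl       rewrite τ-right i             = mk⇔ (λ _ → 1+i∈A) (λ _ → i∈A)
... | outside x≢i x≢1+i rewrite τ-outside x≢i x≢1+i = ⇔.refl

map-τ-↭ : ∀ i {A} → Unique A → i ∈ A → suc i ∈ A → map (τ i) A ↭ A
map-τ-↭ i uA i∈A 1+i∈A =
  ∼bag⇒↭ (unique∧set⇒bag (Unique.map⁺ (τ-injective i) uA) uA
           (⇔.trans (∈-map-τ i) (τ-preserves-∈ i i∈A 1+i∈A)))

-- Ranks

rank-∷-< : ∀ {a A r} → a < r → rank (a ∷ A) r ≡ suc (rank A r)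
rank-∷-< {r = r} a<r = cong length (filter-accept (_<? r) a<r)

rank-∷-≮ : ∀ {a A r} → a ≮ r → rank (a ∷ A) r ≡ rank A r
rank-∷-≮ {r = r} a≮r = cong length (filter-reject (_<? r) a≮r)

rank-map : ∀ f {A r s} → All (λ a → f a < r ⇔ a < s) A → rank (map f A) r ≡ rank A s
rank-map f []                          = refl
rank-map f {a ∷ A} {r} {s} (fa<r⇔a<s ∷ rest) with f a <? r
... | yes fa<r = begin
  rank (f a ∷ map f A) r ≡⟨ rank-∷-< fa<r ⟩
  suc (rank (map f A) r) ≡⟨ cong suc (rank-map f rest) ⟩
  suc (rank A s)         ≡⟨ rank-∷-< (Equivalence.to fa<r⇔a<s fa<r) ⟨
  rank (a ∷ A) s         ∎
  where open ≡-Reasoning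
... | no fa≮r = begin
  rank (f a ∷ map f A) r ≡⟨ rank-∷-≮ fa≮r ⟩
  rank (map f A) r       ≡⟨ rank-map f rest ⟩
  rank A s               ≡⟨ rank-∷-≮ (fa≮r ∘ Equivalence.from fa<r⇔a<s) ⟨
  rank (a ∷ A) s         ∎
  where open ≡-Reasoning

rank-map-τ : ∀ i {A r} → ¬ (i ∈ A × suc i ∈ A) → τ i r ∈ A →
             rank (map (τ i) A) r ≡ rank A (τ i r)
rank-map-τ i {A} {r} not-both τr∈A = rank-map (τ i) (All.tabulate τa<r⇔a<τr)
  where
  τa<r⇔a<τr : ∀ {a} → a ∈ A → τ i a < r ⇔ a < τ i r
  τa<r⇔a<τr {a} a∈A = subst (λ x → τ i a < x ⇔ a < τ i r) (τ-involutive i r)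
    (τ-preserves-< i (λ (a≡i , τr≡1+i) → not-both (∈-subst a≡i a∈A , ∈-subst τr≡1+i τr∈A))
                     (λ (a≡1+i , τr≡i) → not-both (∈-subst τr≡i τr∈A , ∈-subst a≡1+i a∈A)))
    where
    ∈-subst : ∀ {x y} → x ≡ y → x ∈ A → y ∈ A
    ∈-subst = subst (_∈ A)

rank-resp-↭ : ∀ {A B} r → A ↭ B → rank A r ≡ rank B r
rank-resp-↭ r A↭B =
  ↭-length (↭ₛ⇒↭ (Permutationₛ.filter⁺ (setoid ℕ) (_<? r) (λ { refl → id }) (↭⇒↭ₛ A↭B)))

rank-mono : ∀ A {r r'} → r ≤ r' → rank A r ≤ rank A r'
rank-mono []      r≤r' = z≤n
rank-mono (a ∷ A) {r} {r'} r≤r' with a <? r | a <? r'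
... | yes a<r | no a≮r' = contradiction (<-≤-trans a<r r≤r') a≮r'
... | yes a<r | yes a<r' rewrite rank-∷-< {A = A} a<r | rank-∷-< {A = A} a<r' = s≤s (rank-mono A r≤r')
... | no a≮r  | yes a<r' rewrite rank-∷-≮ {A = A} a≮r | rank-∷-< {A = A} a<r' = m≤n⇒m≤1+n (rank-mono A r≤r')
... | no a≮r  | no a≮r'  rewrite rank-∷-≮ {A = A} a≮r | rank-∷-≮ {A = A} a≮r' = rank-mono A r≤r'

rank-strictMono : ∀ {A r r'} → r ∈ A → r < r' → rank A r < rank A r'
rank-strictMono {r ∷ A} {r} {r'} (here refl) r<r'
  rewrite rank-∷-≮ {A = A} (n≮n r) | rank-∷-< {A = A} r<r' = s≤s (rank-mono A (<⇒≤ r<r'))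
rank-strictMono {a ∷ A} {r} {r'} (there r∈A) r<r' with a <? r | a <? r'
... | yes a<r | no a≮r' = contradiction (<-trans a<r r<r') a≮r'
... | yes a<r | yes a<r' rewrite rank-∷-< {A = A} a<r | rank-∷-< {A = A} a<r' = s<s (rank-strictMono r∈A r<r')
... | no a≮r  | yes a<r' rewrite rank-∷-≮ {A = A} a≮r | rank-∷-< {A = A} a<r' = m<n⇒m<1+n (rank-strictMono r∈A r<r')
... | no a≮r  | no a≮r'  rewrite rank-∷-≮ {A = A} a≮r | rank-∷-≮ {A = A} a≮r' = rank-strictMono r∈A r<r'

rank-injective : ∀ {A r r'} → r ∈ A → r' ∈ A → rank A r ≡ rank A r' → r ≡ r'
rank-injective r∈A r'∈A eq with <-cmp _ _
... | tri< r<r' _ _ = contradiction eq (<⇒≢ (rank-strictMono r∈A r<r'))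
... | tri≈ _ r≡r' _ = r≡r'
... | tri> _ _ r'<r = contradiction (sym eq) (<⇒≢ (rank-strictMono r'∈A r'<r))

rank<length : ∀ {A r} → r ∈ A → rank A r < length A
rank<length {A} {r} r∈A = filter-notAll (_<? r) A (Any.map (λ { refl → n≮n r }) r∈A)

-- Decoding block sequences

Ĩ-suc : ∀ u {r t j} → nth (xs u) t ≡ just j → Ĩ u r (suc t) ≡ (r ≡ᵇ j)
Ĩ-suc u {t = t} eq with nth (xs u) t
Ĩ-suc u refl | just _ = refl

Ĩ-bound : ∀ u {r} t → Ĩ u r t ≡ true → r ≤ maxList (ind u)
Ĩ-bound u zero    eq = ∈⇒≤maxList {l = ind u} (∈-++⁺ˡ (elem⇒∈ {l = θs u} eq))
Ĩ-bound u {r} (suc t) eq with nth (xs u) t in xt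
... | just j with refl ← ≡ᵇ⇒≡ r j (subst T (sym eq) _) = ∈⇒≤maxList (∈-++⁺ʳ (θs u) (nth-∈ xt))

letter : ℕ → Seq → ℕ → ℕ
letter B S t = fromMaybe0 (findFirst (λ r → S r t) (range1 B))

module _ (n : ℕ) where

  VanishesAbove : ℕ → Seq → Set
  VanishesAbove B S = ∀ r t → B < r → t ≤ n → S r t ≡ false

  BlocksDisjoint : Seq → Set
  BlocksDisjoint S = ∀ {r r' t} → t < n → S r (suc t) ≡ true → S r' (suc t) ≡ true → r ≡ r'

  decode-length : ∀ B S → length (xs (decode n B S)) ≡ n
  decode-length B S = begin
    length (map (letter B S) (range1 n)) ≡⟨ length-map (letter B S) (range1 n) ⟩
    length (range1 n)                    ≡⟨ cong length (range1≡applyUpTo n) ⟩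
    length (applyUpTo suc n)             ≡⟨ length-applyUpTo suc n ⟩
    n                                    ∎
    where open ≡-Reasoning

  VanishesAbove-mono : ∀ {B C S} → B ≤ C → VanishesAbove B S → VanishesAbove C S
  VanishesAbove-mono B≤C vanishes r t C<r = vanishes r t (≤-<-trans B≤C C<r)

  VanishesAbove⇒≤ : ∀ {B S r t} → VanishesAbove B S → t ≤ n → S r t ≡ true → r ≤ B
  VanishesAbove⇒≤ {B} {S} {r} {t} vanishes t≤n Srt with r ≤? B
  ... | yes r≤B = r≤B
  ... | no r≰B  = contradiction (trans (sym Srt) (vanishes r t (≰⇒> r≰B) t≤n)) λ ()

  decode-extend : ∀ {B S} → VanishesAbove B S → decode n B S ≡ decode n (suc B) S
  decode-extend {B} {S} vanishes = cong₂ mon θs-extend xs-extend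
    where
    P? : Decidable (λ r → S r 0 ≡ true)
    P? r = S r 0 Bool.≟ true
    θs-extend : filter P? (range1 B) ≡ filter P? (range1 (suc B))
    θs-extend = begin
      filter P? (range1 B)                        ≡⟨ ++-identityʳ _ ⟨
      filter P? (range1 B) ++ []                  ≡⟨ cong (filter P? (range1 B) ++_) (filter-none P? (¬P[1+B] ∷ [])) ⟨
      filter P? (range1 B) ++ filter P? [ suc B ] ≡⟨ filter-++ P? (range1 B) [ suc B ] ⟨
      filter P? (range1 B ++ [ suc B ])           ≡⟨ cong (filter P?) (range1-suc B) ⟨
      filter P? (range1 (suc B))                  ∎
      where
      open ≡-Reasoning
      ¬P[1+B] : S (suc B) 0 ≢ true
      ¬P[1+B] eq = contradiction (trans (sym eq) (vanishes (suc B) 0 ≤-refl z≤n)) λ ()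
    xs-extend : map (letter B S) (range1 n) ≡ map (letter (suc B) S) (range1 n)
    xs-extend = map-cong-local (All.tabulate λ t∈ → cong fromMaybe0 (sym (begin
      findFirst (λ r → S r _) (range1 (suc B))        ≡⟨ cong (findFirst _) (range1-suc B) ⟩
      findFirst (λ r → S r _) (range1 B ++ [ suc B ]) ≡⟨ findFirst-++-none _ (range1 B) (S[1+B] t∈ ∷ []) ⟩
      findFirst (λ r → S r _) (range1 B)              ∎)))
      where
      open ≡-Reasoning
      S[1+B] : ∀ {t} → t ∈ range1 n → S (suc B) t ≡ false
      S[1+B] t∈ = vanishes (suc B) _ ≤-refl (proj₂ (Equivalence.to ∈-range1 t∈))

  decode-extend-≤ : ∀ {B C S} → VanishesAbove B S → B ≤ C → decode n B S ≡ decode n C S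
  decode-extend-≤ {B} {S = S} vanishes B≤C = go (≤⇒≤′ B≤C)
    where
    go : ∀ {C} → B ≤′ C → decode n B S ≡ decode n C S
    go (≤′-reflexive refl) = refl
    go (≤′-step B≤′C)      = trans (go B≤′C) (decode-extend (VanishesAbove-mono (≤′⇒≤ B≤′C) vanishes))

  decode-cong-bounded : ∀ {C S S'} → (∀ r t → 1 ≤ r → r ≤ C → t ≤ n → S r t ≡ S' r t) →
                        decode n C S ≡ decode n C S'
  decode-cong-bounded {C} {S} {S'} agree = cong₂ mon
    (filter-cong-local _ _ (All.tabulate λ r∈ → same-θ (Equivalence.to ∈-range1 r∈)))
    (map-cong-local (All.tabulate λ t∈ → cong fromMaybe0 (findFirst-cong-local
      (All.tabulate λ r∈ → same-x (Equivalence.to ∈-range1 r∈) (Equivalence.to ∈-range1 t∈)))))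
    where
    same-θ : ∀ {r} → 1 ≤ r × r ≤ C → (S r 0 ≡ true) ⇔ (S' r 0 ≡ true)
    same-θ (1≤r , r≤C) rewrite agree _ 0 1≤r r≤C z≤n = ⇔.refl
    same-x : ∀ {r t} → 1 ≤ r × r ≤ C → 1 ≤ t × t ≤ n → S r t ≡ S' r t
    same-x (1≤r , r≤C) (_ , t≤n) = agree _ _ 1≤r r≤C t≤n

  decode-cong : ∀ {B B' S S'} → VanishesAbove B S → VanishesAbove B' S' →
                (∀ r t → 1 ≤ r → t ≤ n → S r t ≡ S' r t) → decode n B S ≡ decode n B' S'
  decode-cong {B} {B'} vanishes vanishes' agree = begin
    decode n B _         ≡⟨ decode-extend-≤ vanishes (m≤m⊔n B B') ⟩
    decode n (B ⊔ B') _  ≡⟨ decode-cong-bounded {B ⊔ B'} (λ r t 1≤r _ → agree r t 1≤r) ⟩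
    decode n (B ⊔ B') _  ≡⟨ decode-extend-≤ vanishes' (m≤n⊔m B B') ⟨
    decode n B' _        ∎
    where open ≡-Reasoning

  ≡ᵇ-letter : ∀ {B S r t} → VanishesAbove B S → BlocksDisjoint S → 1 ≤ r → t < n →
              (r ≡ᵇ letter B S (suc t)) ≡ S r (suc t)
  ≡ᵇ-letter {B} {S} {r} {t} vanishes disjoint 1≤r t<n
    with findFirst (λ r → S r (suc t)) (range1 B) in found
  ... | just x with Sx ← findFirst-just (λ r → S r (suc t)) {range1 B} found | r ≟ x
  ...   | yes refl = trans (≡ᵇ-true (refl {x = r})) (sym Sx)
  ...   | no r≢x   = trans (≡ᵇ-false r≢x) (sym (¬-not λ Sr → r≢x (disjoint t<n Sr Sx)))
  ≡ᵇ-letter {B} {S} {r} {t} vanishes disjoint 1≤r t<n | nothing =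
    trans (≡ᵇ-false (≢-sym (<⇒≢ 1≤r))) (sym (¬-not λ Sr → contradiction (trans (sym Sr) (S≡false Sr)) λ ()))
    where
    S≡false : S r (suc t) ≡ true → S r (suc t) ≡ false
    S≡false Sr = findFirst-nothing (λ r → S r (suc t)) {range1 B} found
                   (Equivalence.from ∈-range1 (1≤r , VanishesAbove⇒≤ vanishes t<n Sr))

  Ĩ-decode : ∀ {B S r t} → VanishesAbove B S → BlocksDisjoint S → 1 ≤ r → t ≤ n →
             Ĩ (decode n B S) r t ≡ S r t
  Ĩ-decode {B} {S} {r} {zero} vanishes _ 1≤r _ with S r 0 in Sr0
  ... | true  = elem-true {l = filter _ (range1 B)} (∈-filter⁺ (λ r → S r 0 Bool.≟ true)
                  (Equivalence.from ∈-range1 (1≤r , VanishesAbove⇒≤ vanishes z≤n Sr0)) Sr0)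
  ... | false = elem-false {l = filter _ (range1 B)} λ r∈ →
                  contradiction (trans (sym Sr0) (proj₂ (∈-filter⁻ (λ r → S r 0 Bool.≟ true) {xs = range1 B} r∈))) λ ()
  Ĩ-decode {B} {S} {r} {suc t} vanishes disjoint 1≤r t<n =
    trans (Ĩ-suc (decode n B S) (nth-map (letter B S) {range1 n} (nth-range1 t<n)))
          (≡ᵇ-letter vanishes disjoint 1≤r t<n)

-- The monomials A^I

blockOf : ∀ {n} → List (Subset (suc n)) → ℕ → ℕ → Bool
blockOf I p t with nthBlock I p
... | just b  = inSub b t
... | nothing = false

inSub-true : ∀ {m} (b : Vec Bool m) {t} → inSub b t ≡ true → ∃ λ (f : Fin m) → toℕ f ≡ t × f ∈ₛ b
inSub-true (true ∷ b)  {zero}  _  = Fin.zero , refl , here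
inSub-true (_ ∷ b)     {suc t} eq with f , f≡t , f∈b ← inSub-true b eq = Fin.suc f , cong suc f≡t , there f∈b

∈ₛ⇒inSub : ∀ {m} {b : Vec Bool m} {f} → f ∈ₛ b → inSub b (toℕ f) ≡ true
∈ₛ⇒inSub here        = refl
∈ₛ⇒inSub (there f∈b) = ∈ₛ⇒inSub f∈b

blockOf-just : ∀ {n} {I : List (Subset (suc n))} {p b t} → nthBlock I p ≡ just b → blockOf I p t ≡ inSub b t
blockOf-just {I = I} {p} eq with nthBlock I p
blockOf-just refl | just _ = refl

blockOf-true : ∀ {n} (I : List (Subset (suc n))) {p t} → blockOf I p t ≡ true →
               ∃ λ b → nthBlock I p ≡ just b × inSub b t ≡ true
blockOf-true I {p} eq with nthBlock I p
... | just b = b , refl , eq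

nthBlock-All : ∀ {n} {P : Subset (suc n) → Set} {I p} → All P I → p < length I →
               ∃ λ b → nthBlock I p ≡ just b × P b
nthBlock-All {p = zero}  (Pb ∷ _)  _         = _ , refl , Pb
nthBlock-All {p = suc p} (_ ∷ PI)  (s≤s p<) = nthBlock-All PI p<

Ĩ∘τ-vanishes : ∀ m i u → VanishesAbove m (suc i ⊔ maxList (ind u)) (λ r → Ĩ u (τ i r))
Ĩ∘τ-vanishes m i u r t bound<r _
  rewrite τ-fixes-large {i} (≤-<-trans (m≤m⊔n (suc i) (maxList (ind u))) bound<r) =
  ¬-not λ Ĩurt → <⇒≱ bound<r (≤-trans (Ĩ-bound u t Ĩurt) (m≤n⊔m (suc i) (maxList (ind u))))

module _ {n : ℕ} (I : List (Subset (suc n))) where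

  powSeq-≡ : ∀ A r t → powSeq A I r t ≡ does (r ∈? A) ∧ blockOf I (rank A r) t
  powSeq-≡ A r t with elem r A | elem≡does r A
  ... | false | elem≡does = cong (_∧ blockOf I (rank A r) t) elem≡does
  ... | true  | elem≡does rewrite sym elem≡does with nthBlock I (rank A r)
  ...   | just b  = refl
  ...   | nothing = refl

  powSeq-∉ : ∀ A {r} t → r ∉ A → powSeq A I r t ≡ false
  powSeq-∉ A {r} t r∉A = trans (powSeq-≡ A r t) (cong (_∧ blockOf I (rank A r) t) (dec-false (r ∈? A) r∉A))

  powSeq-vanishes : ∀ A → VanishesAbove n (maxList A) (powSeq A I)
  powSeq-vanishes A r t max<r _ = powSeq-∉ A t λ r∈A → <⇒≱ max<r (∈⇒≤maxList r∈A)

  pow-resp-↭ : ∀ {A B} → A ↭ B → pow A I ≡ pow B I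
  pow-resp-↭ {A} {B} A↭B = decode-cong n (powSeq-vanishes A) (powSeq-vanishes B) λ r t _ _ → begin
    powSeq A I r t                                  ≡⟨ powSeq-≡ A r t ⟩
    does (r ∈? A) ∧ blockOf I (rank A r) t          ≡⟨ cong₂ _∧_ ∈A≡∈B (cong (λ p → blockOf I p t) (rank-resp-↭ r A↭B)) ⟩
    does (r ∈? B) ∧ blockOf I (rank B r) t          ≡⟨ powSeq-≡ B r t ⟨
    powSeq B I r t                                  ∎
    where
    open ≡-Reasoning
    ∈A≡∈B : ∀ {r} → does (r ∈? A) ≡ does (r ∈? B)
    ∈A≡∈B {r} = does-≡ (r ∈? A) (Dec.map (mk⇔ (∈-resp-↭ (↭-sym A↭B)) (∈-resp-↭ A↭B)) (r ∈? B))

  powSeq-τ : ∀ i {A r t} → ¬ (i ∈ A × suc i ∈ A) → powSeq A I (τ i r) t ≡ powSeq (map (τ i) A) I r t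
  powSeq-τ i {A} {r} {t} not-both rewrite powSeq-≡ A (τ i r) t | powSeq-≡ (map (τ i) A) r t with τ i r ∈? A
  ... | yes τr∈A rewrite dec-true (r ∈? map (τ i) A) (Equivalence.from (∈-map-τ i) τr∈A) =
    cong (λ p → blockOf I p t) (sym (rank-map-τ i not-both τr∈A))
  ... | no τr∉A  rewrite dec-false (r ∈? map (τ i) A) (τr∉A ∘ Equivalence.to (∈-map-τ i)) = refl

module _ {n : ℕ} {I : List (Subset (suc n))} (isSSC : IsSetSupercomp n I) where
  open IsSetSupercomp isSSC

  powSeq-true : ∀ {A r t} → powSeq A I r t ≡ true →
                r ∈ A × ∃ λ b → nthBlock I (rank A r) ≡ just b × inSub b t ≡ true
  powSeq-true {A} {r} {t} eq with r ∈? A | trans (sym (powSeq-≡ I A r t)) eq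
  ... | yes r∈A | inBlock = r∈A , blockOf-true I inBlock
  ... | no _    | ()

  powSeq-disjoint : ∀ A → BlocksDisjoint n (powSeq A I)
  powSeq-disjoint A {r} {r'} {t} _ Sr Sr'
    with r∈A  , b  , Ib  , t∈b  ← powSeq-true {A} {r} {suc t} Sr
       | r'∈A , b' , Ib' , t∈b' ← powSeq-true {A} {r'} {suc t} Sr'
    with f  , f≡t  , f∈b  ← inSub-true b  t∈b
       | f' , f'≡t , f'∈b' ← inSub-true b' t∈b'
    with rank A r ≟ rank A r'
  ... | yes same-rank = rank-injective r∈A r'∈A same-rank
  ... | no  rank≢     with refl ← toℕ-injective (trans f≡t (sym f'≡t)) =
    contradiction (trans (sym f≡t) (cong toℕ f≡0)) λ ()
    where
    f≡0 : f ≡ Fin.zero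
    f≡0 = disjoint (rank A r) (rank A r') b b' rank≢ Ib Ib' f f∈b f'∈b'

  powSeq-occupied : ∀ {A r} → length A ≡ length I → r ∈ A → ∃ λ t → t ≤ n × powSeq A I r t ≡ true
  powSeq-occupied {A} {r} |A|≡|I| r∈A
    with b , Ib , (f , f∈b) ← nthBlock-All nonempty (subst (rank A r <_) |A|≡|I| (rank<length r∈A)) =
    toℕ f , s≤s⁻¹ (toℕ<n f) ,
    trans (powSeq-≡ I A r (toℕ f)) (cong₂ _∧_ (dec-true (r ∈? A) r∈A) (trans (blockOf-just {I = I} Ib) (∈ₛ⇒inSub f∈b)))

  Ĩ-pow : ∀ A {r t} → 1 ≤ r → t ≤ n → Ĩ (pow A I) r t ≡ powSeq A I r t
  Ĩ-pow A = Ĩ-decode n (powSeq-vanishes I A) (powSeq-disjoint A)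

  blockEmpty-pow : ∀ {A r} → length A ≡ length I → 1 ≤ r → blockEmpty (pow A I) r ≡ not (does (r ∈? A))
  blockEmpty-pow {A} {r} |A|≡|I| 1≤r =
    trans (allB≡does (not ∘ Ĩ (pow A I) r) ts)
          (does-≡ (All.all? (T? ∘ not ∘ Ĩ (pow A I) r) ts) (Dec.map (mk⇔ from to) (¬? (r ∈? A))))
    where
    ts : List ℕ
    ts = upTo (suc (length (xs (pow A I))))
    |xs|≡n : length (xs (pow A I)) ≡ n
    |xs|≡n = decode-length n (maxList A) (powSeq A I)
    t≤n : ∀ {t} → t ∈ ts → t ≤ n
    t≤n t∈ = subst (_ ≤_) |xs|≡n (s≤s⁻¹ (∈-upTo⁻ t∈))
    to : All (T ∘ not ∘ Ĩ (pow A I) r) ts → r ∉ A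
    to empty r∈A with t , t≤n' , occupied ← powSeq-occupied {A} |A|≡|I| r∈A =
      subst (T ∘ not) (trans (Ĩ-pow A 1≤r t≤n') occupied)
        (All.lookup empty (∈-upTo⁺ (s≤s (subst (t ≤_) (sym |xs|≡n) t≤n'))))
    from : r ∉ A → All (T ∘ not ∘ Ĩ (pow A I) r) ts
    from r∉A = All.tabulate λ t∈ → subst (T ∘ not) (sym (trans (Ĩ-pow A 1≤r (t≤n t∈)) (powSeq-∉ I A _ r∉A))) _

  -- the branch of sAct i (pow A I) that swaps blocks i and suc i
  decode-Ĩ∘τ-pow : ∀ {A i} → 1 ≤ i → ¬ (i ∈ A × suc i ∈ A) →
    decode (length (xs (pow A I))) (suc i ⊔ maxList (ind (pow A I))) (λ r → Ĩ (pow A I) (τ i r))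
      ≡ pow (map (τ i) A) I
  decode-Ĩ∘τ-pow {A} {i} 1≤i not-both rewrite decode-length n (maxList A) (powSeq A I) =
    decode-cong n (Ĩ∘τ-vanishes n i (pow A I)) (powSeq-vanishes I (map (τ i) A))
      λ r t 1≤r t≤n → trans (Ĩ-pow A (τ-positive 1≤i 1≤r) t≤n) (powSeq-τ I i not-both)

  sAct-pow : ∀ {A i} → Unique A → length A ≡ length I → 1 ≤ i → sAct i (pow A I) ≡ pow (map (τ i) A) I
  sAct-pow {A} {i} uA |A|≡|I| 1≤i
    rewrite blockEmpty-pow {A} {i} |A|≡|I| 1≤i | blockEmpty-pow {A} {suc i} |A|≡|I| (s≤s z≤n)
    with i ∈? A | suc i ∈? A
  ... | yes i∈A | yes 1+i∈A = sym (pow-resp-↭ I (map-τ-↭ i uA i∈A 1+i∈A))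
  ... | yes _   | no 1+i∉A  = decode-Ĩ∘τ-pow 1≤i λ (_ , 1+i∈A) → 1+i∉A 1+i∈A
  ... | no i∉A  | _         = decode-Ĩ∘τ-pow 1≤i λ (i∈A , _) → i∉A i∈A

  act-pow : ∀ w → All (1 ≤_) w → ∀ {A} → Unique A → length A ≡ length I →
            act w (pow A I) ≡ pow (map (perm w) A) I
  act-pow []      []          {A} _  _       = cong (λ A → pow A I) (sym (map-id A))
  act-pow (i ∷ w) (1≤i ∷ 1≤w) {A} uA |A|≡|I| = begin
    sAct i (act w (pow A I))            ≡⟨ cong (sAct i) (act-pow w 1≤w uA |A|≡|I|) ⟩
    sAct i (pow (map (perm w) A) I)     ≡⟨ sAct-pow (Unique.map⁺ (perm-injective w) uA)
                                                    (trans (length-map (perm w) A) |A|≡|I|) 1≤i ⟩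
    pow (map (τ i) (map (perm w) A)) I  ≡⟨ cong (λ A → pow A I) (map-∘ A) ⟨
    pow (map (perm (i ∷ w)) A) I        ∎
    where open ≡-Reasoning

proposition4p2 : (n : ℕ) (I : List (Subset (suc n))) → IsSetSupercomp n I →
                 (A : List ℕ) → Unique A → All (1 ≤_) A → length A ≡ length I →
                 (w : List ℕ) → All (1 ≤_) w →
                 act w (pow A I) ≡ pow (map (perm w) A) I
proposition4p2 n I isSSC A uA _ |A|≡|I| w 1≤w = act-pow isSSC w 1≤w uA |A|≡|I|
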